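{- Let $m\geq 1$ and let $\Lambda_m,\Delta_m\subset\mathbb{R}^{2^m}$ and $\Lambda_{m+1}\subset\mathbb{R}^{2^{m+1}}$ be the lattices and $\iota,\tau$ the maps defined below. Then $$\Lambda_{m+1}=\{\iota(\ell)+\iota(d)+\tau(\ell)\mid \ell\in\Lambda_m,\ d\in\Delta_m\}.$$
   Context: For $k\geq 1$ let $\mathcal{V}_k=\mathbb{F}_2^k$ and let $(e_v\mid v\in\mathcal{V}_k)$ be an orthonormal basis of $\mathbb{R}^{2^k}$ indexed by $\mathcal{V}_k$; let $\Gamma_k$ be its $\mathbb{Z}$-span. For $\mathcal{U}\subseteq\mathcal{V}_k$ put $x_{\mathcal{U}}=\sum_{v\in\mathcal{U}}e_v$. For $\lambda=(\lambda_0,\ldots,\lambda_k)\in\mathbb{Z}^{k+1}$ let $\Lambda(\lambda)$ be the $\mathbb{Z}$-span of all $2^{\lambda_{k-r}}x_{\mathcal{U}}$ with $0\leq r\leq k$ and $\mathcal{U}$ an affine subspace of $\mathcal{V}_k$ of dimension $r$. Put $\Lambda_k=\Lambda(\lambda)$ with $\lambda_r=\lfloor r/2\rfloor$ and $\Delta_k=\Lambda(\mu)$ with $\mu_r=\lfloor (r+1)/2\rfloor$ ($0\le r\le k$). Fix a basis $(v_1,\ldots,v_{m+1})$ of $\mathcal{V}_{m+1}$, identify $\mathcal{V}_m$ with $\langle v_1,\ldots,v_m\rangle$ via the natural embedding $\iota:\mathcal{V}_m\hookrightarrow\mathcal{V}_{m+1}$, and let $\tau:\mathcal{V}_m\to\mathcal{V}_{m+1}$,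 $v\mapsto v_{m+1}+\iota(v)$. Also write $\iota,\tau:\Gamma_m\to\Gamma_{m+1}$ for the $\mathbb{Z}$-linear maps with $\iota(e_v)=e_{\iota(v)}$ and $\tau(e_v)=e_{\tau(v)}$ for all $v\in\mathcal{V}_m$. -}

module Defs where

open import Data.Bool using (Bool; true; false; _xor_)
import Data.Bool.Properties as BoolP
open import Data.Nat using (ℕ; zero; suc; _∸_; _≤_; _^_)
open import Data.Nat.DivMod using (_/_)
open import Data.Integer using (ℤ; +_; _+_; _*_)
open import Data.List using (List; []; _∷_; _++_; map; filter; length; foldr; [_])
open import Data.Vec using (Vec; []; _∷_; zipWith; replicate)
open import Data.Vec.Properties using (≡-dec)
open import Data.Product using (Σ; _×_; _,_; ∃)
open import Relation.Binary.PropositionalEquality using (_≡_)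
open import Relation.Binary using (DecidableEquality)

V : ℕ → Set
V k = Vec Bool k

_⊕_ : ∀ {k} → V k → V k → V k
_⊕_ = zipWith _xor_

𝟘 : ∀ {k} → V k
𝟘 = replicate _ false

_≟V_ : ∀ {k} → DecidableEquality (V k)
_≟V_ = ≡-dec BoolP._≟_

allV : (k : ℕ) → List (V k)
allV zero = [ [] ]
allV (suc k) = map (false ∷_) (allV k) ++ map (true ∷_) (allV k)

-- Γ_k = ℤ^{𝒱_k}, vectors written in the basis (e_v); equality is pointwise
Γ : ℕ → Set
Γ k = V k → ℤ

_≐_ : ∀ {k} → Γ k → Γ k → Set
x ≐ y = ∀ v → x v ≡ y v

_+Γ_ : ∀ {k} → Γ k → Γ k → Γ k
(x +Γ y) v = x v + y v

lincomb : ∀ {k r} → Vec Bool r → Vec (V k) r → V k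
lincomb [] [] = 𝟘
lincomb (false ∷ c) (w ∷ ws) = lincomb c ws
lincomb (true ∷ c) (w ∷ ws) = w ⊕ lincomb c ws

Independent : ∀ {k r} → Vec (V k) r → Set
Independent {r = r} ws = ∀ (c : Vec Bool r) → lincomb c ws ≡ 𝟘 → c ≡ replicate r false

-- the affine subspace 𝒰 = p + ⟨w_1,…,w_r⟩ (dimension r when ws independent):
-- x_𝒰 (v) = #{ c ∈ 𝔽₂^r | p + Σ c_i w_i = v }, which is the indicator of 𝒰
xAff : ∀ {k r} → V k → Vec (V k) r → Γ k
xAff {r = r} p ws v = + length (filter (λ c → (p ⊕ lincomb c ws) ≟V v) (allV r))

record AffSub (k : ℕ) : Set where
  constructor affSub
  field
    dim   : ℕ
    dim≤k : dim ≤ k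
    base  : V k
    dirs  : Vec (V k) dim
    indep : Independent dirs

gen : (λs : ℕ → ℕ) (k : ℕ) → AffSub k → Γ k
gen λs k (affSub r _ p ws _) v = (+ (2 ^ λs (k ∸ r))) * xAff p ws v

InSpan : ∀ {k} {I : Set} → (I → Γ k) → Γ k → Set
InSpan {k} {I} g x = Σ (List (ℤ × I)) λ cs →
  x ≐ (λ v → foldr _+_ (+ 0) (map (λ { (a , i) → a * g i v }) cs))

-- Λ(λ) (here λ_r ≥ 0 given as a function of r, only r ≤ k matters)
InΛ : (λs : ℕ → ℕ) (k : ℕ) → Γ k → Set
InΛ λs k = InSpan (gen λs k)

lamΛ : ℕ → ℕ
lamΛ r = r / 2

lamΔ : ℕ → ℕ
lamΔ r = suc r / 2

Λ_ : (k : ℕ) → Γ k → Set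
Λ_ = InΛ lamΛ

Δ_ : (k : ℕ) → Γ k → Set
Δ_ = InΛ lamΔ

-- basis of 𝒱_{m+1}: v_{m+1} is the first coordinate, v_1..v_m the remaining ones
ιV : ∀ {m} → V m → V (suc m)
ιV v = false ∷ v

τV : ∀ {m} → V m → V (suc m)
τV v = true ∷ v

ιΓ : ∀ {m} → Γ m → Γ (suc m)
ιΓ x (false ∷ v) = x v
ιΓ x (true ∷ v) = + 0

τΓ : ∀ {m} → Γ m → Γ (suc m)
τΓ x (false ∷ v) = + 0
τΓ x (true ∷ v) = x v

-- Split x ∈ Γ_{m+1} into its restrictions to the cosets ι(𝒱_m) and τ(𝒱_m).  The ℤ-linear maps
-- x ↦ (ℓ, d) = (x∘τ, x∘ι − x∘τ) and (ℓ, d) ↦ ι ℓ + ι d + τ ℓ are mutually inverse, so it suffices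
-- to check each of them on generators.  A generator 2^{λ_{m-r}} x_U of Λ_m goes to the generator
-- 2^{λ_{m-r}} x_{U + ⟨v_{m+1}⟩} of Λ_{m+1}, and ι of a generator 2^{μ_{m-r}} x_U of Δ_m is the
-- generator 2^{λ_{m+1-r}} x_{ι U}.  Conversely, row reduction on the v_{m+1}-coordinate shows that an
-- affine subspace of 𝒱_{m+1} either lies in one coset, where ℓ and d are (±) multiples of generators
-- because λ_n ≤ μ_n = λ_{n+1}, or equals ι U₀ ∪ τ(U₀ + a) for an affine U₀ ⊆ 𝒱_m.  In the latter
-- case ℓ is a generator and d = 2^λ (x_{U₀} − x_{U₀+a}) = 2^{λ+1} x_{U₀} − 2^λ x_{U₀+⟨a⟩} (or 0 when
-- a is a direction of U₀), which lies in Δ_m since μ_n ≤ λ_n + 1.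

module Submission where

open import Defs
open import Data.Bool using (Bool; true; false; not)
open import Data.Bool.Properties
  using (xor-assoc; xor-comm; xor-identityˡ; xor-identityʳ; xor-same)
open import Data.Empty using (⊥-elim)
open import Data.Integer using (ℤ; +_; -[1+_]; _+_; _*_; _-_)
import Data.Integer.Properties as ℤₚ
open import Data.Integer.Solver using (module +-*-Solver)
open import Data.List using (List; []; _∷_; _++_; map; filter; length; foldr)
import Data.List.Relation.Unary.All as ListAll
open import Data.List.Properties using (filter-++; filter-≐; filter-none; length-++)
open import Data.Nat as ℕ using (ℕ; zero; suc; _∸_; _≤_; _≥_; _^_; z≤n; s≤s)
import Data.Nat.Properties as ℕₚ
open import Algebra.Properties.CommutativeSemigroup ℕₚ.+-commutativeSemigroup
  using (interchange)
open import Data.Nat.DivMod using (/-monoˡ-≤; m/n≡1+[m∸n]/n)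
open import Data.Product using (Σ; ∃; _×_; _,_; proj₁; proj₂)
open import Data.Vec using (Vec; []; _∷_; head; tail) renaming (map to vmap)
open import Data.Vec.Properties
  using (zipWith-assoc; zipWith-comm; zipWith-identityˡ; zipWith-identityʳ; ∷-injective)
open import Data.Vec.Relation.Unary.All as All using (All; []; _∷_)
open import Function using (_∘_)
open import Relation.Binary.PropositionalEquality
open import Relation.Nullary using (¬_; Dec; yes; no; does)

open +-*-Solver using (solve; _:=_; _:+_; _:*_; _:-_; con)

private
  variable
    k m r : ℕ

⊕-assoc : (x y z : V k) → (x ⊕ y) ⊕ z ≡ x ⊕ (y ⊕ z)
⊕-assoc = zipWith-assoc xor-assoc

⊕-comm : (x y : V k) → x ⊕ y ≡ y ⊕ x
⊕-comm = zipWith-comm xor-comm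

⊕-identityˡ : (x : V k) → 𝟘 ⊕ x ≡ x
⊕-identityˡ = zipWith-identityˡ xor-identityˡ

⊕-identityʳ : (x : V k) → x ⊕ 𝟘 ≡ x
⊕-identityʳ = zipWith-identityʳ xor-identityʳ

⊕-self : (x : V k) → x ⊕ x ≡ 𝟘
⊕-self []      = refl
⊕-self (b ∷ x) = cong₂ _∷_ (xor-same b) (⊕-self x)

⊕-cancelˡ : (x y : V k) → x ⊕ (x ⊕ y) ≡ y
⊕-cancelˡ x y = begin
  x ⊕ (x ⊕ y) ≡⟨ ⊕-assoc x x y ⟨
  (x ⊕ x) ⊕ y ≡⟨ cong (_⊕ y) (⊕-self x) ⟩
  𝟘 ⊕ y       ≡⟨ ⊕-identityˡ y ⟩
  y           ∎
  where open ≡-Reasoning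

⊕-cancelʳ : (x y : V k) → (x ⊕ y) ⊕ y ≡ x
⊕-cancelʳ x y = begin
  (x ⊕ y) ⊕ y ≡⟨ ⊕-assoc x y y ⟩
  x ⊕ (y ⊕ y) ≡⟨ cong (x ⊕_) (⊕-self y) ⟩
  x ⊕ 𝟘       ≡⟨ ⊕-identityʳ x ⟩
  x           ∎
  where open ≡-Reasoning

⊕-swapˡ : (x y z : V k) → x ⊕ (y ⊕ z) ≡ y ⊕ (x ⊕ z)
⊕-swapˡ x y z = begin
  x ⊕ (y ⊕ z) ≡⟨ ⊕-assoc x y z ⟨
  (x ⊕ y) ⊕ z ≡⟨ cong (_⊕ z) (⊕-comm x y) ⟩
  (y ⊕ x) ⊕ z ≡⟨ ⊕-assoc y x z ⟩
  y ⊕ (x ⊕ z) ∎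
  where open ≡-Reasoning

⊕-swapʳ : (x y z : V k) → (x ⊕ y) ⊕ z ≡ (x ⊕ z) ⊕ y
⊕-swapʳ x y z = begin
  (x ⊕ y) ⊕ z ≡⟨ ⊕-assoc x y z ⟩
  x ⊕ (y ⊕ z) ≡⟨ cong (x ⊕_) (⊕-comm y z) ⟩
  x ⊕ (z ⊕ y) ≡⟨ ⊕-assoc x z y ⟨
  (x ⊕ z) ⊕ y ∎
  where open ≡-Reasoning

⊕-interchange : (x y z w : V k) → (x ⊕ y) ⊕ (z ⊕ w) ≡ (x ⊕ z) ⊕ (y ⊕ w)
⊕-interchange x y z w = begin
  (x ⊕ y) ⊕ (z ⊕ w) ≡⟨ ⊕-assoc x y (z ⊕ w) ⟩
  x ⊕ (y ⊕ (z ⊕ w)) ≡⟨ cong (x ⊕_) (⊕-swapˡ y z w) ⟩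
  x ⊕ (z ⊕ (y ⊕ w)) ≡⟨ ⊕-assoc x z (y ⊕ w) ⟨
  (x ⊕ z) ⊕ (y ⊕ w) ∎
  where open ≡-Reasoning

ιs : Vec (V m) r → Vec (V (suc m)) r
ιs = vmap ιV

lincomb-𝟘 : (ws : Vec (V k) r) → lincomb 𝟘 ws ≡ 𝟘
lincomb-𝟘 []       = refl
lincomb-𝟘 (w ∷ ws) = lincomb-𝟘 ws

lincomb-⊕ : (c c' : Vec Bool r) (ws : Vec (V k) r) →
            lincomb (c ⊕ c') ws ≡ lincomb c ws ⊕ lincomb c' ws
lincomb-⊕ []          []           []       = sym (⊕-identityʳ 𝟘)
lincomb-⊕ (false ∷ c) (false ∷ c') (w ∷ ws) = lincomb-⊕ c c' ws
lincomb-⊕ (false ∷ c) (true  ∷ c') (w ∷ ws) =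
  trans (cong (w ⊕_) (lincomb-⊕ c c' ws)) (⊕-swapˡ w _ _)
lincomb-⊕ (true  ∷ c) (false ∷ c') (w ∷ ws) =
  trans (cong (w ⊕_) (lincomb-⊕ c c' ws)) (sym (⊕-assoc w _ _))
lincomb-⊕ (true  ∷ c) (true  ∷ c') (w ∷ ws) = begin
  lincomb (c ⊕ c') ws                      ≡⟨ lincomb-⊕ c c' ws ⟩
  lincomb c ws ⊕ lincomb c' ws             ≡⟨ ⊕-identityˡ _ ⟨
  𝟘 ⊕ (lincomb c ws ⊕ lincomb c' ws)       ≡⟨ cong (_⊕ _) (⊕-self w) ⟨
  (w ⊕ w) ⊕ (lincomb c ws ⊕ lincomb c' ws) ≡⟨ ⊕-interchange w w _ _ ⟩
  (w ⊕ lincomb c ws) ⊕ (w ⊕ lincomb c' ws) ∎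
  where open ≡-Reasoning

lincomb-ι : (c : Vec Bool r) (us : Vec (V m) r) → lincomb c (ιs us) ≡ false ∷ lincomb c us
lincomb-ι []          []       = refl
lincomb-ι (false ∷ c) (u ∷ us) = lincomb-ι c us
lincomb-ι (true  ∷ c) (u ∷ us) = cong ((false ∷ u) ⊕_) (lincomb-ι c us)

_∈⟨_⟩ : V k → Vec (V k) r → Set
u ∈⟨ ws ⟩ = ∃ λ c → lincomb c ws ≡ u

𝟘∈⟨⟩ : (ws : Vec (V k) r) → 𝟘 ∈⟨ ws ⟩
𝟘∈⟨⟩ ws = 𝟘 , lincomb-𝟘 ws

∈⟨⟩-⊕ : {ws : Vec (V k) r} {x y : V k} → x ∈⟨ ws ⟩ → y ∈⟨ ws ⟩ → (x ⊕ y) ∈⟨ ws ⟩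
∈⟨⟩-⊕ {ws = ws} (c , refl) (c' , refl) = c ⊕ c' , lincomb-⊕ c c' ws

∈⟨⟩-here : (w : V k) (ws : Vec (V k) r) → w ∈⟨ w ∷ ws ⟩
∈⟨⟩-here w ws = true ∷ 𝟘 , trans (cong (w ⊕_) (lincomb-𝟘 ws)) (⊕-identityʳ w)

∈⟨⟩-there : {w u : V k} {ws : Vec (V k) r} → u ∈⟨ ws ⟩ → u ∈⟨ w ∷ ws ⟩
∈⟨⟩-there (c , e) = false ∷ c , e

∈⟨⟩-ι : {u : V m} {us : Vec (V m) r} → u ∈⟨ us ⟩ → (false ∷ u) ∈⟨ ιs us ⟩
∈⟨⟩-ι {us = us} (c , refl) = c , lincomb-ι c us

∈⟨⟩-trans : {r' : ℕ} {ws : Vec (V k) r} {us : Vec (V k) r'} {u : V k} →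
            All (_∈⟨ ws ⟩) us → u ∈⟨ us ⟩ → u ∈⟨ ws ⟩
∈⟨⟩-trans {ws = ws} []         ([] , refl)        = 𝟘∈⟨⟩ ws
∈⟨⟩-trans           (_ ∷ sub)  (false ∷ c , refl) = ∈⟨⟩-trans sub (c , refl)
∈⟨⟩-trans           (w∈ ∷ sub) (true  ∷ c , refl) = ∈⟨⟩-⊕ w∈ (∈⟨⟩-trans sub (c , refl))

_∈⟨_⟩? : (u : V k) (ws : Vec (V k) r) → Dec (u ∈⟨ ws ⟩)
u ∈⟨ [] ⟩? with u ≟V 𝟘
... | yes refl = yes ([] , refl)
... | no  u≢𝟘  = no λ { ([] , e) → u≢𝟘 (sym e) }
u ∈⟨ w ∷ ws ⟩? with u ∈⟨ ws ⟩? | (w ⊕ u) ∈⟨ ws ⟩?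
... | yes (c , e) | _           = yes (false ∷ c , e)
... | no  _       | yes (c , e) = yes (true ∷ c , trans (cong (w ⊕_) e) (⊕-cancelˡ w u))
... | no  u∉      | no  w⊕u∉    = no λ
  { (false ∷ c , e) → u∉ (c , e)
  ; (true  ∷ c , e) → w⊕u∉ (c , trans (sym (⊕-cancelˡ w _)) (cong (w ⊕_) e)) }

Independent-∷⁻ : {w : V k} {ws : Vec (V k) r} →
                 Independent (w ∷ ws) → ¬ w ∈⟨ ws ⟩ × Independent ws
Independent-∷⁻ {w = w} ind =
  (λ { (c , e) → true≢false (cong head (ind (true ∷ c) (trans (cong (w ⊕_) e) (⊕-self w)))) }) ,
  (λ c e → cong tail (ind (false ∷ c) e))
  where
  true≢false : ¬ true ≡ false
  true≢false ()

Independent-∷⁺ : {w : V k} {ws : Vec (V k) r} →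
                 ¬ w ∈⟨ ws ⟩ → Independent ws → Independent (w ∷ ws)
Independent-∷⁺ w∉ ind (false ∷ c) e = cong (false ∷_) (ind c e)
Independent-∷⁺ {w = w} {ws} w∉ ind (true ∷ c) e =
  ⊥-elim (w∉ (c , trans (sym (⊕-cancelˡ w _)) (trans (cong (w ⊕_) e) (⊕-identityʳ w))))

Independent-ι : {us : Vec (V m) r} → Independent us → Independent (ιs us)
Independent-ι {us = us} ind c e = ind c (cong tail (trans (sym (lincomb-ι c us)) e))

τ∉⟨ι⟩ : (a : V m) (us : Vec (V m) r) → ¬ (true ∷ a) ∈⟨ ιs us ⟩
τ∉⟨ι⟩ a us (c , e) with trans (sym (lincomb-ι c us)) e
... | ()

-- Multiplicities of affine parametrisations

count : {A : Set} → (A → V k) → V k → List A → ℕ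
count f v xs = length (filter (λ a → f a ≟V v) xs)

multiplicity : V k → Vec (V k) r → V k → ℕ
multiplicity {r = r} p ws v = count (λ c → p ⊕ lincomb c ws) v (allV r)

count-++ : {A : Set} (f : A → V k) (v : V k) (xs ys : List A) →
           count f v (xs ++ ys) ≡ count f v xs ℕ.+ count f v ys
count-++ f v xs ys =
  trans (cong length (filter-++ (λ a → f a ≟V v) xs ys))
        (length-++ (filter (λ a → f a ≟V v) xs))

count-map : {A B : Set} (f : A → V k) (g : B → A) (v : V k) (xs : List B) →
            count f v (map g xs) ≡ count (f ∘ g) v xs
count-map f g v []       = refl
count-map f g v (x ∷ xs) with does (f (g x) ≟V v)
... | true  = cong suc (count-map f g v xs)
... | false = count-map f g v xs

count-cong : {A : Set} {f g : A → V k} (v : V k) → (∀ a → f a ≡ g a) → (xs : List A) →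
             count f v xs ≡ count g v xs
count-cong v f≗g xs = cong length (filter-≐ _ _
  ((λ {a} e → trans (sym (f≗g a)) e) , (λ {a} e → trans (f≗g a) e)) xs)

multiplicity-∷ : (p w : V k) (ws : Vec (V k) r) (v : V k) →
                 multiplicity p (w ∷ ws) v ≡ multiplicity p ws v ℕ.+ multiplicity (p ⊕ w) ws v
multiplicity-∷ {r = r} p w ws v = begin
  count F v (map (false ∷_) (allV r) ++ map (true ∷_) (allV r))
    ≡⟨ count-++ F v (map (false ∷_) (allV r)) _ ⟩
  count F v (map (false ∷_) (allV r)) ℕ.+ count F v (map (true ∷_) (allV r))
    ≡⟨ cong₂ ℕ._+_ (count-map F (false ∷_) v (allV r)) (count-map F (true ∷_) v (allV r)) ⟩
  multiplicity p ws v ℕ.+ count (λ c → p ⊕ (w ⊕ lincomb c ws)) v (allV r)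
    ≡⟨ cong (multiplicity p ws v ℕ.+_)
            (count-cong v (λ c → sym (⊕-assoc p w (lincomb c ws))) (allV r)) ⟩
  multiplicity p ws v ℕ.+ multiplicity (p ⊕ w) ws v ∎
  where
  open ≡-Reasoning
  F = λ c → p ⊕ lincomb c (w ∷ ws)

multiplicity-translate-head : (p w : V k) (ws : Vec (V k) r) (v : V k) →
                              multiplicity (p ⊕ w) (w ∷ ws) v ≡ multiplicity p (w ∷ ws) v
multiplicity-translate-head p w ws v = begin
  multiplicity (p ⊕ w) (w ∷ ws) v
    ≡⟨ multiplicity-∷ (p ⊕ w) w ws v ⟩
  multiplicity (p ⊕ w) ws v ℕ.+ multiplicity ((p ⊕ w) ⊕ w) ws v
    ≡⟨ cong (λ q → multiplicity (p ⊕ w) ws v ℕ.+ multiplicity q ws v) (⊕-cancelʳ p w) ⟩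
  multiplicity (p ⊕ w) ws v ℕ.+ multiplicity p ws v
    ≡⟨ ℕₚ.+-comm (multiplicity (p ⊕ w) ws v) _ ⟩
  multiplicity p ws v ℕ.+ multiplicity (p ⊕ w) ws v
    ≡⟨ multiplicity-∷ p w ws v ⟨
  multiplicity p (w ∷ ws) v ∎
  where open ≡-Reasoning

multiplicity-translate : (ws : Vec (V k) r) (c : Vec Bool r) (p v : V k) →
                         multiplicity (p ⊕ lincomb c ws) ws v ≡ multiplicity p ws v

multiplicity-translate-tail : (w : V k) (ws : Vec (V k) r) (c : Vec Bool r) (p v : V k) →
                              multiplicity (p ⊕ lincomb c ws) (w ∷ ws) v ≡ multiplicity p (w ∷ ws) v
multiplicity-translate-tail w ws c p v = begin
  multiplicity (p ⊕ l) (w ∷ ws) v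
    ≡⟨ multiplicity-∷ (p ⊕ l) w ws v ⟩
  multiplicity (p ⊕ l) ws v ℕ.+ multiplicity ((p ⊕ l) ⊕ w) ws v
    ≡⟨ cong (λ q → multiplicity (p ⊕ l) ws v ℕ.+ multiplicity q ws v) (⊕-swapʳ p l w) ⟩
  multiplicity (p ⊕ l) ws v ℕ.+ multiplicity ((p ⊕ w) ⊕ l) ws v
    ≡⟨ cong₂ ℕ._+_ (multiplicity-translate ws c p v) (multiplicity-translate ws c (p ⊕ w) v) ⟩
  multiplicity p ws v ℕ.+ multiplicity (p ⊕ w) ws v
    ≡⟨ multiplicity-∷ p w ws v ⟨
  multiplicity p (w ∷ ws) v ∎
  where
  open ≡-Reasoning
  l = lincomb c ws

multiplicity-translate []       []          p v = cong (λ q → multiplicity q [] v) (⊕-identityʳ p)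
multiplicity-translate (w ∷ ws) (false ∷ c) p v = multiplicity-translate-tail w ws c p v
multiplicity-translate (w ∷ ws) (true  ∷ c) p v = begin
  multiplicity (p ⊕ (w ⊕ lincomb c ws)) (w ∷ ws) v
    ≡⟨ cong (λ q → multiplicity q (w ∷ ws) v) (⊕-assoc p w (lincomb c ws)) ⟨
  multiplicity ((p ⊕ w) ⊕ lincomb c ws) (w ∷ ws) v
    ≡⟨ multiplicity-translate-tail w ws c (p ⊕ w) v ⟩
  multiplicity (p ⊕ w) (w ∷ ws) v
    ≡⟨ multiplicity-translate-head p w ws v ⟩
  multiplicity p (w ∷ ws) v ∎
  where open ≡-Reasoning

⊕-lincomb-ι : (b : Bool) (p : V m) (c : Vec Bool r) (us : Vec (V m) r) →
              (b ∷ p) ⊕ lincomb c (ιs us) ≡ b ∷ (p ⊕ lincomb c us)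
⊕-lincomb-ι b p c us =
  trans (cong ((b ∷ p) ⊕_) (lincomb-ι c us)) (cong (_∷ _) (xor-identityʳ b))

multiplicity-ι : (b : Bool) (p : V m) (us : Vec (V m) r) (v : V m) →
                 multiplicity (b ∷ p) (ιs us) (b ∷ v) ≡ multiplicity p us v
multiplicity-ι {r = r} b p us v = begin
  multiplicity (b ∷ p) (ιs us) (b ∷ v)
    ≡⟨ count-cong (b ∷ v) (λ c → ⊕-lincomb-ι b p c us) (allV r) ⟩
  count (λ c → b ∷ (p ⊕ lincomb c us)) (b ∷ v) (allV r)
    ≡⟨ cong length (filter-≐ (λ c → (b ∷ (p ⊕ lincomb c us)) ≟V (b ∷ v))
                             (λ c → (p ⊕ lincomb c us) ≟V v)
                             ((λ e → proj₂ (∷-injective e)) , cong (b ∷_)) (allV r)) ⟩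
  multiplicity p us v ∎
  where open ≡-Reasoning

multiplicity-ι-other : (b : Bool) (p : V m) (us : Vec (V m) r) (v : V m) →
                       multiplicity (b ∷ p) (ιs us) (not b ∷ v) ≡ 0
multiplicity-ι-other {r = r} b p us v = begin
  multiplicity (b ∷ p) (ιs us) (not b ∷ v)
    ≡⟨ count-cong (not b ∷ v) (λ c → ⊕-lincomb-ι b p c us) (allV r) ⟩
  count (λ c → b ∷ (p ⊕ lincomb c us)) (not b ∷ v) (allV r)
    ≡⟨ cong length (filter-none (λ c → (b ∷ (p ⊕ lincomb c us)) ≟V (not b ∷ v))
                                (ListAll.universal (λ _ e → b≢not-b b (cong head e)) (allV r))) ⟩
  0 ∎
  where
  open ≡-Reasoning
  b≢not-b : ∀ b → ¬ b ≡ not b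
  b≢not-b false ()
  b≢not-b true  ()

record _≈ₘ_ {r r' : ℕ} (ws : Vec (V k) r) (ws' : Vec (V k) r') : Set where
  constructor same-multiplicities
  field multiplicity-≡ : (p v : V k) → multiplicity p ws v ≡ multiplicity p ws' v
open _≈ₘ_

≈ₘ-trans : {r₁ r₂ r₃ : ℕ} {ws₁ : Vec (V k) r₁} {ws₂ : Vec (V k) r₂} {ws₃ : Vec (V k) r₃} →
           ws₁ ≈ₘ ws₂ → ws₂ ≈ₘ ws₃ → ws₁ ≈ₘ ws₃
≈ₘ-trans e e' = same-multiplicities λ p v → trans (multiplicity-≡ e p v) (multiplicity-≡ e' p v)

≈ₘ-sym : {r' : ℕ} {ws : Vec (V k) r} {ws' : Vec (V k) r'} → ws ≈ₘ ws' → ws' ≈ₘ ws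
≈ₘ-sym e = same-multiplicities λ p v → sym (multiplicity-≡ e p v)

≈ₘ-∷ : {r' : ℕ} (w : V k) {ws : Vec (V k) r} {ws' : Vec (V k) r'} →
       ws ≈ₘ ws' → (w ∷ ws) ≈ₘ (w ∷ ws')
≈ₘ-∷ w {ws} {ws'} e = same-multiplicities λ p v → begin
  multiplicity p (w ∷ ws) v
    ≡⟨ multiplicity-∷ p w ws v ⟩
  multiplicity p ws v ℕ.+ multiplicity (p ⊕ w) ws v
    ≡⟨ cong₂ ℕ._+_ (multiplicity-≡ e p v) (multiplicity-≡ e (p ⊕ w) v) ⟩
  multiplicity p ws' v ℕ.+ multiplicity (p ⊕ w) ws' v
    ≡⟨ multiplicity-∷ p w ws' v ⟨
  multiplicity p (w ∷ ws') v ∎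
  where open ≡-Reasoning

≈ₘ-swap : (w w' : V k) (ws : Vec (V k) r) → (w ∷ w' ∷ ws) ≈ₘ (w' ∷ w ∷ ws)
≈ₘ-swap w w' ws = same-multiplicities λ p v → let μ = λ q → multiplicity q ws v in begin
  multiplicity p (w ∷ w' ∷ ws) v
    ≡⟨ multiplicity-∷ p w (w' ∷ ws) v ⟩
  multiplicity p (w' ∷ ws) v ℕ.+ multiplicity (p ⊕ w) (w' ∷ ws) v
    ≡⟨ cong₂ ℕ._+_ (multiplicity-∷ p w' ws v) (multiplicity-∷ (p ⊕ w) w' ws v) ⟩
  (μ p ℕ.+ μ (p ⊕ w')) ℕ.+ (μ (p ⊕ w) ℕ.+ μ ((p ⊕ w) ⊕ w'))
    ≡⟨ interchange (μ p) _ _ _ ⟩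
  (μ p ℕ.+ μ (p ⊕ w)) ℕ.+ (μ (p ⊕ w') ℕ.+ μ ((p ⊕ w) ⊕ w'))
    ≡⟨ cong (λ q → (μ p ℕ.+ μ (p ⊕ w)) ℕ.+ (μ (p ⊕ w') ℕ.+ μ q)) (⊕-swapʳ p w w') ⟩
  (μ p ℕ.+ μ (p ⊕ w)) ℕ.+ (μ (p ⊕ w') ℕ.+ μ ((p ⊕ w') ⊕ w))
    ≡⟨ cong₂ ℕ._+_ (multiplicity-∷ p w ws v) (multiplicity-∷ (p ⊕ w') w ws v) ⟨
  multiplicity p (w ∷ ws) v ℕ.+ multiplicity (p ⊕ w') (w ∷ ws) v
    ≡⟨ multiplicity-∷ p w' (w ∷ ws) v ⟨
  multiplicity p (w' ∷ w ∷ ws) v ∎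
  where open ≡-Reasoning

≈ₘ-add : (w : V k) {u : V k} {ws : Vec (V k) r} → u ∈⟨ ws ⟩ → ((w ⊕ u) ∷ ws) ≈ₘ (w ∷ ws)
≈ₘ-add w {ws = ws} (c , refl) = same-multiplicities λ p v → begin
  multiplicity p ((w ⊕ lincomb c ws) ∷ ws) v
    ≡⟨ multiplicity-∷ p (w ⊕ lincomb c ws) ws v ⟩
  multiplicity p ws v ℕ.+ multiplicity (p ⊕ (w ⊕ lincomb c ws)) ws v
    ≡⟨ cong (λ q → multiplicity p ws v ℕ.+ multiplicity q ws v) (⊕-assoc p w _) ⟨
  multiplicity p ws v ℕ.+ multiplicity ((p ⊕ w) ⊕ lincomb c ws) ws v
    ≡⟨ cong (multiplicity p ws v ℕ.+_) (multiplicity-translate ws c (p ⊕ w) v) ⟩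
  multiplicity p ws v ℕ.+ multiplicity (p ⊕ w) ws v
    ≡⟨ multiplicity-∷ p w ws v ⟨
  multiplicity p (w ∷ ws) v ∎
  where open ≡-Reasoning

-- Row reduction on the v_{m+1}-coordinate

-- The span inclusions are only needed to keep us independent along the induction.
data Echelon {m : ℕ} : {r : ℕ} → Vec (V (suc m)) r → Set where
  horizontal : {ws : Vec (V (suc m)) r} (us : Vec (V m) r) → Independent us →
               ws ≈ₘ ιs us → All (_∈⟨ ws ⟩) (ιs us) → Echelon ws
  pivoted    : {ws : Vec (V (suc m)) (suc r)} (a : V m) (us : Vec (V m) r) → Independent us →
               ws ≈ₘ ((true ∷ a) ∷ ιs us) → All (_∈⟨ ws ⟩) ((true ∷ a) ∷ ιs us) → Echelon ws

echelon-∷ : {ws : Vec (V (suc m)) r} (w : V (suc m)) → ¬ w ∈⟨ ws ⟩ → Echelon ws → Echelon (w ∷ ws)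
echelon-∷ {ws = ws} (false ∷ u) w∉ (horizontal us ind ws≈ sub) =
  horizontal (u ∷ us) (Independent-∷⁺ (λ u∈ → w∉ (∈⟨⟩-trans sub (∈⟨⟩-ι u∈))) ind)
             (≈ₘ-∷ (false ∷ u) ws≈) (∈⟨⟩-here (false ∷ u) ws ∷ All.map ∈⟨⟩-there sub)
echelon-∷ {ws = ws} (true ∷ u) w∉ (horizontal us ind ws≈ sub) =
  pivoted u us ind (≈ₘ-∷ (true ∷ u) ws≈) (∈⟨⟩-here (true ∷ u) ws ∷ All.map ∈⟨⟩-there sub)
echelon-∷ {ws = ws} (false ∷ u) w∉ (pivoted a us ind ws≈ (t∈ ∷ sub)) =
  pivoted a (u ∷ us)
    (Independent-∷⁺ (λ u∈ → w∉ (∈⟨⟩-trans (t∈ ∷ sub) (∈⟨⟩-there (∈⟨⟩-ι u∈)))) ind)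
    (≈ₘ-trans (≈ₘ-∷ w ws≈) (≈ₘ-swap w t (ιs us)))
    (∈⟨⟩-there t∈ ∷ ∈⟨⟩-here w ws ∷ All.map ∈⟨⟩-there sub)
  where
  w = false ∷ u
  t = true ∷ a
-- Eliminating the pivot t from w = true ∷ u leaves w ⊕ t, which reduces to false ∷ (u ⊕ a).
echelon-∷ {ws = ws} (true ∷ u) w∉ (pivoted a us ind ws≈ (t∈ ∷ sub)) =
  pivoted a ((u ⊕ a) ∷ us)
    (Independent-∷⁺ (λ u⊕a∈ → w∉ (∈⟨⟩-trans (t∈ ∷ sub) (w∈ u⊕a∈))) ind)
    (≈ₘ-trans (≈ₘ-∷ w ws≈)
      (≈ₘ-trans
        (≈ₘ-sym (≈ₘ-add w (∈⟨⟩-here t (ιs us)))) (≈ₘ-swap (w ⊕ t) t (ιs us))))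
    (∈⟨⟩-there t∈ ∷ ∈⟨⟩-⊕ (∈⟨⟩-here w ws) (∈⟨⟩-there t∈) ∷ All.map ∈⟨⟩-there sub)
  where
  w = true ∷ u
  t = true ∷ a
  w∈ : (u ⊕ a) ∈⟨ us ⟩ → w ∈⟨ t ∷ ιs us ⟩
  w∈ u⊕a∈ = subst (_∈⟨ t ∷ ιs us ⟩) (trans (⊕-comm t (w ⊕ t)) (⊕-cancelʳ w t))
                  (∈⟨⟩-⊕ (∈⟨⟩-here t (ιs us)) (∈⟨⟩-there (∈⟨⟩-ι u⊕a∈)))

echelon : (ws : Vec (V (suc m)) r) → Independent ws → Echelon ws
echelon []       _   = horizontal [] (λ { [] _ → refl }) (same-multiplicities λ _ _ → refl) []
echelon (w ∷ ws) ind = echelon-∷ w (proj₁ ind⁻) (echelon ws (proj₂ ind⁻))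
  where ind⁻ = Independent-∷⁻ ind

dim-bound : (ws : Vec (V k) r) → Independent ws → r ≤ k
dim-bound {zero}  []       _   = z≤n
dim-bound {zero}  ([] ∷ ws) ind = ⊥-elim (proj₁ (Independent-∷⁻ ind) (𝟘∈⟨⟩ ws))
dim-bound {suc k} ws       ind with echelon ws ind
... | horizontal us ind' _ _ = ℕₚ.m≤n⇒m≤1+n (dim-bound us ind')
... | pivoted  _ us ind' _ _ = s≤s (dim-bound us ind')

combination : {I : Set} → (I → Γ k) → List (ℤ × I) → Γ k
combination g cs v = foldr _+_ (+ 0) (map (λ (a , i) → a * g i v) cs)

module _ {I : Set} (g : I → Γ k) where

  combination-++ : (cs ds : List (ℤ × I)) (v : V k) →
                   combination g (cs ++ ds) v ≡ combination g cs v + combination g ds v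
  combination-++ []             ds v = sym (ℤₚ.+-identityˡ _)
  combination-++ ((a , i) ∷ cs) ds v =
    trans (cong (λ s → a * g i v + s) (combination-++ cs ds v))
          (sym (ℤₚ.+-assoc (a * g i v) (combination g cs v) (combination g ds v)))

  combination-scale : (b : ℤ) (cs : List (ℤ × I)) (v : V k) →
                      combination g (map (λ (a , i) → (b * a , i)) cs) v ≡ b * combination g cs v
  combination-scale b []             v = sym (ℤₚ.*-zeroʳ b)
  combination-scale b ((a , i) ∷ cs) v =
    trans (cong (λ s → (b * a) * g i v + s) (combination-scale b cs v))
          (solve 4 (λ b a x s → (b :* a) :* x :+ b :* s := b :* (a :* x :+ s)) refl b a (g i v) _)

  combination-zero : (cs : List (ℤ × I)) (v : V k) → (∀ i → g i v ≡ + 0) → combination g cs v ≡ + 0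
  combination-zero []             v g≡0 = refl
  combination-zero ((a , i) ∷ cs) v g≡0 = begin
    a * g i v + combination g cs v ≡⟨ cong₂ (λ x y → a * x + y) (g≡0 i) (combination-zero cs v g≡0) ⟩
    a * + 0 + + 0                  ≡⟨ ℤₚ.+-identityʳ (a * + 0) ⟩
    a * + 0                        ≡⟨ ℤₚ.*-zeroʳ a ⟩
    + 0                            ∎
    where open ≡-Reasoning

module _ {J : Set} {h : J → Γ k} where

  span-resp : {x y : Γ k} → x ≐ y → InSpan h y → InSpan h x
  span-resp x≐y (cs , y≐) = cs , λ v → trans (x≐y v) (y≐ v)

  span-zero : InSpan h (λ _ → + 0)
  span-zero = [] , λ _ → refl

  span-generator : (a : ℤ) (j : J) → InSpan h (λ v → a * h j v)
  span-generator a j = (a , j) ∷ [] , λ _ → sym (ℤₚ.+-identityʳ _)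

  span-+ : {x y : Γ k} → InSpan h x → InSpan h y → InSpan h (x +Γ y)
  span-+ (cs , x≐) (ds , y≐) =
    cs ++ ds , λ v → trans (cong₂ _+_ (x≐ v) (y≐ v)) (sym (combination-++ h cs ds v))

  span-scale : {x : Γ k} (b : ℤ) → InSpan h x → InSpan h (λ v → b * x v)
  span-scale b (cs , x≐) =
    map (λ (a , i) → (b * a , i)) cs ,
    λ v → trans (cong (b *_) (x≐ v)) (sym (combination-scale h b cs v))

  span-combination : {I : Set} {f : I → Γ k} → (∀ i → InSpan h (f i)) → (cs : List (ℤ × I)) →
                     InSpan h (combination f cs)
  span-combination f∈ []             = span-zero
  span-combination f∈ ((a , i) ∷ cs) = span-+ (span-scale a (f∈ i)) (span-combination f∈ cs)

span-map : {k' : ℕ} {I J : Set} {g : I → Γ k} {h : J → Γ k'} (φ : Γ k → Γ k') →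
           (∀ {x y} → x ≐ y → φ x ≐ φ y) →
           (∀ cs → φ (combination g cs) ≐ combination (φ ∘ g) cs) →
           (∀ i → InSpan h (φ (g i))) → {x : Γ k} → InSpan g x → InSpan h (φ x)
span-map φ φ-resp φ-linear φg∈ (cs , x≐) =
  span-resp (λ v → trans (φ-resp x≐ v) (φ-linear cs v)) (span-combination φg∈ cs)

lamΛ-mono : {n n' : ℕ} → n ≤ n' → lamΛ n ≤ lamΛ n'
lamΛ-mono = /-monoˡ-≤ 2

lamΛ-2+ : (n : ℕ) → lamΛ (2 ℕ.+ n) ≡ suc (lamΛ n)
lamΛ-2+ n = m/n≡1+[m∸n]/n {2 ℕ.+ n} (s≤s (s≤s z≤n))

lamΔ≤1+lamΛ : (n : ℕ) → lamΔ n ≤ suc (lamΛ n)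
lamΔ≤1+lamΛ n = subst (lamΔ n ≤_) (lamΛ-2+ n) (lamΛ-mono (ℕₚ.n≤1+n (suc n)))

lamΛ-suc-∸ : {n r : ℕ} → r ≤ n → lamΛ (suc n ∸ r) ≡ lamΔ (n ∸ r)
lamΛ-suc-∸ r≤n = cong lamΛ (ℕₚ.+-∸-assoc 1 r≤n)

pow2-split : {l e : ℕ} → l ≤ e → + (2 ^ e) ≡ + (2 ^ (e ∸ l)) * + (2 ^ l)
pow2-split {l} {e} l≤e = begin
  + (2 ^ e)                   ≡⟨ cong (λ n → + (2 ^ n)) (ℕₚ.m∸n+n≡m l≤e) ⟨
  + (2 ^ (e ∸ l ℕ.+ l))       ≡⟨ cong +_ (ℕₚ.^-distribˡ-+-* 2 (e ∸ l) l) ⟩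
  + (2 ^ (e ∸ l) ℕ.* 2 ^ l)   ≡⟨ ℤₚ.pos-* (2 ^ (e ∸ l)) (2 ^ l) ⟩
  + (2 ^ (e ∸ l)) * + (2 ^ l) ∎
  where open ≡-Reasoning

scaled-generator∈ : (λs : ℕ → ℕ) (p : V k) {ws : Vec (V k) r} → Independent ws →
                    {e : ℕ} → λs (k ∸ r) ≤ e → (a : ℤ) →
                    InΛ λs k (λ v → a * (+ (2 ^ e) * xAff p ws v))
scaled-generator∈ {k} {r} λs p {ws} ind {e} l≤e a =
  span-resp rescale (span-generator (a * + (2 ^ (e ∸ l))) (affSub r (dim-bound ws ind) p ws ind))
  where
  l = λs (k ∸ r)
  rescale : ∀ v → a * (+ (2 ^ e) * xAff p ws v) ≡ (a * + (2 ^ (e ∸ l))) * (+ (2 ^ l) * xAff p ws v)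
  rescale v = trans (cong (λ z → a * (z * xAff p ws v)) (pow2-split l≤e))
    (solve 4 (λ a q r x → a :* ((q :* r) :* x) := (a :* q) :* (r :* x)) refl a _ _ _)

-- Restricting generators of Λ_{m+1} to the two cosets of 𝒱_m

ℓ-part : Γ (suc m) → Γ m
ℓ-part x = x ∘ τV

d-part : Γ (suc m) → Γ m
d-part x v = x (ιV v) - x (τV v)

Splits : (m : ℕ) → Γ (suc m) → Set
Splits m x = (Λ m) (ℓ-part x) × (Δ m) (d-part x)

Splits-resp : {x y : Γ (suc m)} → x ≐ y → Splits m y → Splits m x
Splits-resp x≐y (ℓ∈ , d∈) =
  span-resp (λ v → x≐y (τV v)) ℓ∈ , span-resp (λ v → cong₂ _-_ (x≐y (ιV v)) (x≐y (τV v))) d∈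

multiplicity-pivot-ι : (q a : V m) (us : Vec (V m) r) (v : V m) →
                       multiplicity (false ∷ q) ((true ∷ a) ∷ ιs us) (false ∷ v) ≡ multiplicity q us v
multiplicity-pivot-ι q a us v =
  trans (multiplicity-∷ (false ∷ q) (true ∷ a) (ιs us) (false ∷ v))
    (trans (cong₂ ℕ._+_ (multiplicity-ι false q us v) (multiplicity-ι-other true (q ⊕ a) us v))
           (ℕₚ.+-identityʳ _))

multiplicity-pivot-τ : (q a : V m) (us : Vec (V m) r) (v : V m) →
                       multiplicity (false ∷ q) ((true ∷ a) ∷ ιs us) (true ∷ v) ≡ multiplicity (q ⊕ a) us v
multiplicity-pivot-τ q a us v =
  trans (multiplicity-∷ (false ∷ q) (true ∷ a) (ιs us) (true ∷ v))
        (cong₂ ℕ._+_ (multiplicity-ι-other false q us v) (multiplicity-ι true (q ⊕ a) us v))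

pivot-base-ι : (b : Bool) (p a : V m) (us : Vec (V m) r) →
               ∃ λ q → ∀ w → multiplicity (b ∷ p) ((true ∷ a) ∷ ιs us) w
                           ≡ multiplicity (false ∷ q) ((true ∷ a) ∷ ιs us) w
pivot-base-ι false p a us = p , λ _ → refl
pivot-base-ι true  p a us = p ⊕ a , λ w → sym (multiplicity-translate-head (true ∷ p) (true ∷ a) (ιs us) w)

splits-horizontal : (b : Bool) (p : V m) {us : Vec (V m) r} → Independent us →
                    Splits m (λ w → + (2 ^ lamΛ (suc m ∸ r)) * xAff (b ∷ p) (ιs us) w)
splits-horizontal {m} {r} false p {us} ind =
  span-resp ℓ≡0 span-zero ,
  span-resp d≡ (scaled-generator∈ lamΔ p ind (ℕₚ.≤-reflexive lamΔ≡) (+ 1))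
  where
  X = + (2 ^ lamΛ (suc m ∸ r))
  x = λ w → X * xAff (false ∷ p) (ιs us) w
  lamΔ≡ = sym (lamΛ-suc-∸ (dim-bound us ind))
  ℓ≡0 : ∀ v → x (τV v) ≡ + 0
  ℓ≡0 v = trans (cong (λ n → X * + n) (multiplicity-ι-other false p us v)) (ℤₚ.*-zeroʳ X)
  d≡ : ∀ v → d-part x v ≡ + 1 * (X * xAff p us v)
  d≡ v = trans (cong₂ (λ n n' → X * + n - X * + n')
                      (multiplicity-ι false p us v) (multiplicity-ι-other false p us v))
               (solve 2 (λ X y → X :* y :- X :* con (+ 0) := con (+ 1) :* (X :* y)) refl X (xAff p us v))
splits-horizontal {m} {r} true p {us} ind =
  span-resp ℓ≡ (scaled-generator∈ lamΛ p ind (lamΛ-mono (ℕₚ.∸-monoˡ-≤ r (ℕₚ.n≤1+n m))) (+ 1)) ,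
  span-resp d≡ (scaled-generator∈ lamΔ p ind (ℕₚ.≤-reflexive lamΔ≡) -[1+ 0 ])
  where
  X = + (2 ^ lamΛ (suc m ∸ r))
  x = λ w → X * xAff (true ∷ p) (ιs us) w
  lamΔ≡ = sym (lamΛ-suc-∸ (dim-bound us ind))
  ℓ≡ : ∀ v → x (τV v) ≡ + 1 * (X * xAff p us v)
  ℓ≡ v = trans (cong (λ n → X * + n) (multiplicity-ι true p us v)) (sym (ℤₚ.*-identityˡ _))
  d≡ : ∀ v → d-part x v ≡ -[1+ 0 ] * (X * xAff p us v)
  d≡ v = trans (cong₂ (λ n n' → X * + n - X * + n')
                      (multiplicity-ι-other true p us v) (multiplicity-ι true p us v))
               (solve 2 (λ X y → X :* con (+ 0) :- X :* y := con -[1+ 0 ] :* (X :* y)) refl X (xAff p us v))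

splits-pivot : (q a : V m) {us : Vec (V m) r} → Independent us →
               Splits m (λ w → + (2 ^ lamΛ (m ∸ r)) * xAff (false ∷ q) ((true ∷ a) ∷ ιs us) w)
splits-pivot {m} {r} q a {us} ind =
  span-resp ℓ≡ (scaled-generator∈ lamΛ (q ⊕ a) ind ℕₚ.≤-refl (+ 1)) ,
  span-resp d≡ (d∈ (a ∈⟨ us ⟩?))
  where
  X = + (2 ^ lamΛ (m ∸ r))
  x = λ w → X * xAff (false ∷ q) ((true ∷ a) ∷ ιs us) w
  ℓ≡ : ∀ v → x (τV v) ≡ + 1 * (X * xAff (q ⊕ a) us v)
  ℓ≡ v = trans (cong (λ n → X * + n) (multiplicity-pivot-τ q a us v)) (sym (ℤₚ.*-identityˡ _))
  d≡ : ∀ v → d-part x v ≡ X * xAff q us v - X * xAff (q ⊕ a) us v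
  d≡ v = cong₂ (λ n n' → X * + n - X * + n') (multiplicity-pivot-ι q a us v) (multiplicity-pivot-τ q a us v)
  d∈ : Dec (a ∈⟨ us ⟩) → (Δ m) (λ v → X * xAff q us v - X * xAff (q ⊕ a) us v)
  d∈ (yes (c , refl)) = span-resp d≡0 span-zero
    where
    d≡0 : ∀ v → X * xAff q us v - X * xAff (q ⊕ lincomb c us) us v ≡ + 0
    d≡0 v = trans (cong (λ n → X * xAff q us v - X * + n) (multiplicity-translate us c q v))
                  (ℤₚ.+-inverseʳ (X * xAff q us v))
  d∈ (no a∉) = span-resp d≡sum
    (span-+ (scaled-generator∈ lamΔ q ind (lamΔ≤1+lamΛ (m ∸ r)) (+ 1))
            (scaled-generator∈ lamΔ q ind' (ℕₚ.≤-reflexive lamΔ≡) -[1+ 0 ]))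
    where
    ind' = Independent-∷⁺ a∉ ind
    lamΔ≡ : lamΔ (m ∸ suc r) ≡ lamΛ (m ∸ r)
    lamΔ≡ = sym (lamΛ-suc-∸ (dim-bound (a ∷ us) ind'))
    d≡sum : ∀ v → X * xAff q us v - X * xAff (q ⊕ a) us v
                ≡ + 1 * (+ (2 ^ suc (lamΛ (m ∸ r))) * xAff q us v)
                  + -[1+ 0 ] * (X * xAff q (a ∷ us) v)
    d≡sum v = begin
      X * + n₀ - X * + n₁
        ≡⟨ solve 3 (λ X y z → X :* y :- X :* z
                              := con (+ 1) :* ((con (+ 2) :* X) :* y) :+ con -[1+ 0 ] :* (X :* (y :+ z)))
                 refl X (+ n₀) (+ n₁) ⟩
      + 1 * ((+ 2 * X) * + n₀) + -[1+ 0 ] * (X * (+ n₀ + + n₁))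
        ≡⟨ cong₂ (λ y z → + 1 * (y * + n₀) + -[1+ 0 ] * (X * z))
                 (sym (ℤₚ.pos-* 2 (2 ^ lamΛ (m ∸ r))))
                 (trans (sym (ℤₚ.pos-+ n₀ n₁)) (cong +_ (sym (multiplicity-∷ q a us v)))) ⟩
      + 1 * (+ (2 ^ suc (lamΛ (m ∸ r))) * xAff q us v) + -[1+ 0 ] * (X * xAff q (a ∷ us) v) ∎
      where
      open ≡-Reasoning
      n₀ = multiplicity q us v
      n₁ = multiplicity (q ⊕ a) us v

splits-generator : (A : AffSub (suc m)) → Splits m (gen lamΛ (suc m) A)
splits-generator {m} (affSub r _ (b ∷ p) ws ind) with echelon ws ind
... | horizontal us ind' ws≈ _ =
  Splits-resp (λ w → cong (λ n → X * + n) (multiplicity-≡ ws≈ (b ∷ p) w)) (splits-horizontal b p ind')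
  where X = + (2 ^ lamΛ (suc m ∸ r))
... | pivoted a us ind' ws≈ _ with pivot-base-ι b p a us
...   | q , rebase =
  Splits-resp (λ w → cong (λ n → X * + n) (trans (multiplicity-≡ ws≈ (b ∷ p) w) (rebase w)))
              (splits-pivot q a ind')
  where X = + (2 ^ lamΛ (suc m ∸ r))

-- Generators of Λ_m and Δ_m inside Λ_{m+1}

lift : Γ m → Γ (suc m)
lift x = x ∘ tail

lift-generator∈ : (A : AffSub m) → (Λ (suc m)) (lift (gen lamΛ m A))
lift-generator∈ (affSub r _ p ws ind) =
  span-resp lift≡ (scaled-generator∈ lamΛ (false ∷ p) ind' ℕₚ.≤-refl (+ 1))
  where
  X = + (2 ^ lamΛ (_ ∸ r))
  ind' = Independent-∷⁺ (τ∉⟨ι⟩ 𝟘 ws) (Independent-ι ind)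
  lift≡ : ∀ w → X * xAff p ws (tail w) ≡ + 1 * (X * xAff (false ∷ p) ((true ∷ 𝟘) ∷ ιs ws) w)
  lift≡ (false ∷ v) = trans (cong (λ n → X * + n) (sym (multiplicity-pivot-ι p 𝟘 ws v)))
                            (sym (ℤₚ.*-identityˡ _))
  lift≡ (true ∷ v)  = trans (cong (λ q → X * xAff q ws v) (sym (⊕-identityʳ p)))
                            (trans (cong (λ n → X * + n) (sym (multiplicity-pivot-τ p 𝟘 ws v)))
                                   (sym (ℤₚ.*-identityˡ _)))

ι-generator∈ : (A : AffSub m) → (Λ (suc m)) (ιΓ (gen lamΔ m A))
ι-generator∈ (affSub r r≤m p ws ind) =
  span-resp ι≡ (scaled-generator∈ lamΛ (false ∷ p) (Independent-ι ind)
                                  (ℕₚ.≤-reflexive (lamΛ-suc-∸ r≤m)) (+ 1))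
  where
  Y = + (2 ^ lamΔ (_ ∸ r))
  ι≡ : ∀ w → ιΓ (λ v → Y * xAff p ws v) w ≡ + 1 * (Y * xAff (false ∷ p) (ιs ws) w)
  ι≡ (false ∷ v) = trans (cong (λ n → Y * + n) (sym (multiplicity-ι false p ws v)))
                         (sym (ℤₚ.*-identityˡ _))
  ι≡ (true ∷ v)  = sym (trans (ℤₚ.*-identityˡ _)
                              (trans (cong (λ n → Y * + n) (multiplicity-ι-other false p ws v))
                                     (ℤₚ.*-zeroʳ Y)))

d-part-combination : {I : Set} (g : I → Γ (suc m)) (cs : List (ℤ × I)) →
                     d-part (combination g cs) ≐ combination (d-part ∘ g) cs
d-part-combination g []             v = refl
d-part-combination g ((a , i) ∷ cs) v = begin
  (a * g i (ιV v) + s) - (a * g i (τV v) + t)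
    ≡⟨ solve 5 (λ a x y s t → (a :* x :+ s) :- (a :* y :+ t) := a :* (x :- y) :+ (s :- t))
             refl a (g i (ιV v)) (g i (τV v)) s t ⟩
  a * (g i (ιV v) - g i (τV v)) + (s - t)
    ≡⟨ cong (λ z → a * (g i (ιV v) - g i (τV v)) + z) (d-part-combination g cs v) ⟩
  a * d-part (g i) v + combination (d-part ∘ g) cs v ∎
  where
  open ≡-Reasoning
  s = combination g cs (ιV v)
  t = combination g cs (τV v)

ιΓ-combination : {I : Set} (g : I → Γ m) (cs : List (ℤ × I)) →
                 ιΓ (combination g cs) ≐ combination (ιΓ ∘ g) cs
ιΓ-combination g cs (false ∷ v) = refl
ιΓ-combination g cs (true ∷ v)  = sym (combination-zero (ιΓ ∘ g) cs (true ∷ v) (λ _ → refl))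

ιΓ-resp : {x y : Γ m} → x ≐ y → ιΓ x ≐ ιΓ y
ιΓ-resp x≐y (false ∷ v) = x≐y v
ιΓ-resp x≐y (true ∷ v)  = refl

ℓ-part∈Λ : {x : Γ (suc m)} → (Λ (suc m)) x → (Λ m) (ℓ-part x)
ℓ-part∈Λ = span-map ℓ-part (λ e v → e (τV v)) (λ _ _ → refl) (proj₁ ∘ splits-generator)

d-part∈Δ : {x : Γ (suc m)} → (Λ (suc m)) x → (Δ m) (d-part x)
d-part∈Δ {m} = span-map d-part (λ e v → cong₂ _-_ (e (ιV v)) (e (τV v)))
                        (d-part-combination (gen lamΛ (suc m))) (proj₂ ∘ splits-generator)

lift∈Λ : {ℓ : Γ m} → (Λ m) ℓ → (Λ (suc m)) (lift ℓ)
lift∈Λ = span-map lift (λ e w → e (tail w)) (λ _ _ → refl) lift-generator∈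

ιΓ∈Λ : {d : Γ m} → (Δ m) d → (Λ (suc m)) (ιΓ d)
ιΓ∈Λ {m} = span-map ιΓ ιΓ-resp (ιΓ-combination (gen lamΔ m)) ι-generator∈

recombine-parts : (x : Γ (suc m)) → x ≐ ((ιΓ (ℓ-part x) +Γ ιΓ (d-part x)) +Γ τΓ (ℓ-part x))
recombine-parts x (false ∷ v) =
  solve 2 (λ y z → y := (z :+ (y :- z)) :+ con (+ 0)) refl (x (false ∷ v)) (x (true ∷ v))
recombine-parts x (true ∷ v)  = sym (ℤₚ.+-identityˡ _)

ι+ι+τ≐lift+ι : (ℓ d : Γ m) → ((ιΓ ℓ +Γ ιΓ d) +Γ τΓ ℓ) ≐ (lift ℓ +Γ ιΓ d)
ι+ι+τ≐lift+ι ℓ d (false ∷ v) = ℤₚ.+-identityʳ _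
ι+ι+τ≐lift+ι ℓ d (true ∷ v)  = ℤₚ.+-comm (+ 0 + + 0) (ℓ v)

mainTheorem3 : (m : ℕ) → m ≥ 1 → (x : Γ (suc m)) →
    ((Λ (suc m)) x → Σ (Γ m) λ ℓ → Σ (Γ m) λ d →
        (Λ m) ℓ × (Δ m) d × (x ≐ ((ιΓ ℓ +Γ ιΓ d) +Γ τΓ ℓ)))
    × ((Σ (Γ m) λ ℓ → Σ (Γ m) λ d →
        (Λ m) ℓ × (Δ m) d × (x ≐ ((ιΓ ℓ +Γ ιΓ d) +Γ τΓ ℓ))) → (Λ (suc m)) x)
mainTheorem3 m _ x =
  (λ x∈ → ℓ-part x , d-part x , ℓ-part∈Λ x∈ , d-part∈Δ x∈ , recombine-parts x) ,
  (λ (ℓ , d , ℓ∈ , d∈ , x≐) →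
     span-resp (λ w → trans (x≐ w) (ι+ι+τ≐lift+ι ℓ d w)) (span-+ (lift∈Λ ℓ∈) (ιΓ∈Λ d∈)))
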